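{- (Admissibility of weakening.) Let $\Gamma,\Delta$ be finite multisets of compound diagrams, $D$ a compound diagram and $n\ge 0$. (i) If $\Gamma\Rightarrow\Delta$ has a proof in $\mathsf{LJ}_{EV}$ of height at most $n$, then so does $D,\Gamma\Rightarrow\Delta$. (ii) If $\Gamma\Rightarrow\Delta$ has a proof in $\mathsf{LJ}_{EV}$ of height at most $n$, then so does $\Gamma\Rightarrow\Delta,D$.
   Context: The height of a proof is the largest number of successive rule applications along a branch (a proof consisting of an axiom or a zero-premiss rule instance has height $0$). Fix a countable set $\mathcal V$ of propositional variables (contours). A zone for finite $L\subset\mathcal V$ is a pair $z=(z^{in},z^{out})$ of disjoint subsets of $L$ with union $L$; $\mathcal Z(L)$ = all zones. Unitary diagrams: Venn diagrams $(L,\mathcal Z(L),S)$ with $S\subseteq\mathcal Z(L)$ shaded; pure Euler diagrams $d=(L,Z)$, $Z\subseteq\mathcal Z(L)$, missing zones $M(d)=\mathcal Z(L)\setminus Z$; Euler–Venn diagrams $d=(L,Z,S)$, $S\subseteq Z$, with $\mathrm{venn}(d)=(L,\mathcal Z(L),S)$, $\mathrm{euler}(d)=(L,Z)$. Special Venn diagrams: $\bot=(\emptyset,\{(\emptyset,\emptyset)\},\emptyset)$, $\top=(\emptyset,\{(\emptyset,\emptyset)\},\{(\emptyset,\emptyset)\})$, positive literal $p_c=(\{c\},\mathcal Z(\{c\}),\{(\{c\},\emptyset)\})$, negative literal $n_c=(\{c\},\mathcal Z(\{c\}),\{(\emptyset,\{c\})\})$. For $c\in L$: $\mathrm{adj}(z,c)$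 is $z$ with $c$ moved to the other side; $z\setminus c=(z^{in}\setminus\{c\},z^{out}\setminus\{c\})$; $(L,Z)\setminus c=(L\setminus\{c\},\{z\setminus c\mid z\in Z\})$. Compound diagrams: $D::=d\mid D\wedge D\mid D\vee D\mid D\to D$, $d$ unitary. A sequent $\Gamma\Rightarrow\Delta$ consists of finite multisets of compound diagrams. $\mathsf{LJ}_{EV}$: a proof is a finite tree of sequents built by the rules below ("premisses / conclusion", $\Gamma,\Delta$ arbitrary) whose leaves are axioms $p_c,\Gamma\Rightarrow\Delta,p_c$ or instances of ($\bot$L) $\bot,\Gamma\Rightarrow\Delta$ or ($\top$R) $\Gamma\Rightarrow\Delta,\top$. (∧L) $D,E,\Gamma\Rightarrow\Delta$ / $D\wedge E,\Gamma\Rightarrow\Delta$; (∨L) $D,\Gamma\Rightarrow\Delta$ and $E,\Gamma\Rightarrow\Delta$ / $D\vee E,\Gamma\Rightarrow\Delta$; (→L) $\Gamma,D\to E\Rightarrow D$ and $E,\Gamma\Rightarrow\Delta$ / $D\to E,\Gamma\Rightarrow\Delta$; (∧R) $\Gamma\Rightarrow\Delta,D$ and $\Gamma\Rightarrow\Delta,E$ / $\Gamma\Rightarrow\Delta,D\wedge E$; (∨R) $\Gamma\Rightarrow\Delta,D,E$ / $\Gamma\Rightarrow\Delta,D\vee E$; (→R) $D,\Gamma\Rightarrow E$ / $\Gamma\Rightarrow\Delta,D\to E$. (LitL) $n_c,\Gamma\Rightarrow p_c$ / $n_c,\Gamma\Rightarrow\Delta$; (LitR) $p_c,\Gamma\Rightarrow$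 / $\Gamma\Rightarrow\Delta,n_c$; for Venn $d=(L,\mathcal Z(L),S)$, $|S|>1$, $d_i=(L,\mathcal Z(L),S_i)$, $S=S_1\cup S_2$: (SepL) $d_1,\Gamma\Rightarrow\Delta$ and $d_2,\Gamma\Rightarrow\Delta$ / $d,\Gamma\Rightarrow\Delta$; (SepR) $\Gamma\Rightarrow\Delta,d_1,d_2$ / $\Gamma\Rightarrow\Delta,d$; for Venn $d$ with only shaded zone $(\{n_1..n_k\},\{o_1..o_l\})$: (DecL) $p_{n_1},..,p_{n_k},n_{o_1},..,n_{o_l},\Gamma\Rightarrow\Delta$ / $d,\Gamma\Rightarrow\Delta$; (DecR) all $\Gamma\Rightarrow\Delta,p_{n_i}$ and all $\Gamma\Rightarrow\Delta,n_{o_j}$ / $\Gamma\Rightarrow\Delta,d$. For pure Euler $d=(L,Z)$ where every $z\in M(d)$ has $\ell\in L$ with $\mathrm{adj}(z,\ell)\in M(d)$, and $\{c_1..c_k\}\subseteq L$ maximal with $M(d\setminus c_i)\ne\emptyset$: (RedL) $d\setminus c_1,..,d\setminus c_k,\Gamma\Rightarrow\Delta$ / $d,\Gamma\Rightarrow\Delta$; (RedR) all $\Gamma\Rightarrow\Delta,d\setminus c_i$ / $\Gamma\Rightarrow\Delta,d$. For pure Euler $d=(L,Z)$ with $|M(d)|>1$, $d_1=(L,Z_1),d_2=(L,Z_2)$, $Z_1\cap Z_2=Z$: (MSepL) $d_1,d_2,\Gamma\Rightarrow\Delta$ / $d,\Gamma\Rightarrow\Delta$; (MSepR) $\Gamma\Rightarrow\Delta,d_1$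 and $\Gamma\Rightarrow\Delta,d_2$ / $\Gamma\Rightarrow\Delta,d$. For pure Euler $d$ with single missing zone $(\{n_1..n_k\},\{o_1..o_l\})$: (ImpDecL) all $d,\Gamma\Rightarrow p_{n_i}$ and all $p_{o_j},\Gamma\Rightarrow\Delta$ / $d,\Gamma\Rightarrow\Delta$; (ImpDecR) $\Gamma,p_{n_1},..,p_{n_k}\Rightarrow p_{o_1},..,p_{o_l}$ / $\Gamma\Rightarrow\Delta,d$. For Euler–Venn $d$: (DetL) $d,\Gamma\Rightarrow\mathrm{euler}(d)$ and $\mathrm{venn}(d),\Gamma\Rightarrow\Delta$ / $d,\Gamma\Rightarrow\Delta$; (DetR) $\mathrm{euler}(d),\Gamma\Rightarrow\mathrm{venn}(d)$ / $\Gamma\Rightarrow\Delta,d$. -}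

module Defs where

open import Data.Nat using (ℕ; zero; suc; _≟_)
open import Data.List using (List; []; _∷_; _++_; map; filter)
open import Data.List.Membership.Propositional using (_∈_; _∉_)
open import Data.List.Membership.DecPropositional _≟_ using (_∈?_)
open import Data.List.Relation.Unary.Any using (Any)
open import Data.List.Relation.Unary.All using (All)
open import Data.List.Relation.Unary.Unique.Propositional using (Unique)
open import Data.List.Relation.Binary.Pointwise using (Pointwise)
open import Data.List.Relation.Binary.Permutation.Propositional using (_↭_)
open import Data.Product using (Σ; ∃; _×_; _,_)
open import Data.Sum using (_⊎_)
open import Data.Empty using (⊥)
open import Relation.Nullary using (¬_; ¬?; yes; no)

-- Finite sets are represented by lists; all notions below are extensional,
-- i.e. only membership matters (order and duplicates are irrelevant),
-- except where a set is *enumerated* into a multiset of a sequent, where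
-- a duplicate-free enumeration is demanded explicitly (see Enum).

_iff_ : Set → Set → Set
A iff B = (A → B) × (B → A)

Contour : Set
Contour = ℕ

CSet : Set
CSet = List Contour

_≐_ : CSet → CSet → Set
A ≐ B = ∀ c → (c ∈ A) iff (c ∈ B)

record Zone : Set where
  constructor ⟨_,_⟩
  field
    zin  : CSet
    zout : CSet
open Zone public

_≈z_ : Zone → Zone → Set
z ≈z w = (zin z ≐ zin w) × (zout z ≐ zout w)

ZoneOf : CSet → Zone → Set
ZoneOf L z = (∀ c → c ∈ zin z → c ∉ zout z)
           × (∀ c → (c ∈ L) iff (c ∈ zin z ⊎ c ∈ zout z))

ZSet : Set
ZSet = List Zone

_∈z_ : Zone → ZSet → Set
z ∈z Z = Any (z ≈z_) Z

_≐z_ : ZSet → ZSet → Set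
Z ≐z W = ∀ z → (z ∈z Z) iff (z ∈z W)

IsAllZones : CSet → ZSet → Set
IsAllZones L Z = ∀ z → (z ∈z Z) iff ZoneOf L z

Missing : CSet → ZSet → Zone → Set
Missing L Z z = ZoneOf L z × ¬ (z ∈z Z)

TwoDistinct : (Zone → Set) → Set
TwoDistinct P = Σ Zone λ z₁ → Σ Zone λ z₂ → P z₁ × P z₂ × ¬ (z₁ ≈z z₂)

Enum : List Contour → (Contour → Set) → Set
Enum cs P = Unique cs × (∀ c → (c ∈ cs) iff P c)

del : Contour → CSet → CSet
del c = filter (λ x → ¬? (x ≟ c))

zdel : Contour → Zone → Zone
zdel c z = ⟨ del c (zin z) , del c (zout z) ⟩

adj : Zone → Contour → Zone
adj z ℓ with ℓ ∈? zin z
... | yes _ = ⟨ del ℓ (zin z) , ℓ ∷ zout z ⟩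
... | no  _ = ⟨ ℓ ∷ zin z , del ℓ (zout z) ⟩

-- unitary diagrams: Euler–Venn diagrams (L,Z,S) (Venn diagrams being those
-- with Z = 𝒵(L)) and pure Euler diagrams (L,Z)
data Unitary : Set where
  ev : CSet → ZSet → ZSet → Unitary
  eu : CSet → ZSet → Unitary

_≈u_ : Unitary → Unitary → Set
ev L Z S ≈u ev L' Z' S' = (L ≐ L') × (Z ≐z Z') × (S ≐z S')
eu L Z   ≈u eu L' Z'    = (L ≐ L') × (Z ≐z Z')
_        ≈u _           = ⊥

data CD : Set where
  unit : Unitary → CD
  _∧_  : CD → CD → CD
  _∨_  : CD → CD → CD
  _⟶_  : CD → CD → CD

WFU : Unitary → Set
WFU (ev L Z S) = All (ZoneOf L) Z × All (_∈z Z) S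
WFU (eu L Z)   = All (ZoneOf L) Z

WFD : CD → Set
WFD (unit d) = WFU d
WFD (D ∧ E)  = WFD D × WFD E
WFD (D ∨ E)  = WFD D × WFD E
WFD (D ⟶ E)  = WFD D × WFD E

𝒵₀ : ZSet
𝒵₀ = ⟨ [] , [] ⟩ ∷ []

𝒵₁ : Contour → ZSet
𝒵₁ c = ⟨ c ∷ [] , [] ⟩ ∷ ⟨ [] , c ∷ [] ⟩ ∷ []

dbot : Unitary
dbot = ev [] 𝒵₀ []

dtop : Unitary
dtop = ev [] 𝒵₀ 𝒵₀

pos : Contour → Unitary
pos c = ev (c ∷ []) (𝒵₁ c) (⟨ c ∷ [] , [] ⟩ ∷ [])

neg : Contour → Unitary
neg c = ev (c ∷ []) (𝒵₁ c) (⟨ [] , c ∷ [] ⟩ ∷ [])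

P : Contour → CD
P c = unit (pos c)

N : Contour → CD
N c = unit (neg c)

IsDel : Unitary → Contour → Unitary → Set
IsDel (eu L Z) c (eu L' Z') = (L' ≐ del c L) × (Z' ≐z map (zdel c) Z)
IsDel _ _ _ = ⊥

RedCond : CSet → ZSet → Set
RedCond L Z = ∀ z → Missing L Z z → Σ Contour λ ℓ → ℓ ∈ L × Missing L Z (adj z ℓ)

RedContour : CSet → ZSet → Contour → Set
RedContour L Z c = c ∈ L × ∃ (Missing (del c L) (map (zdel c) Z))

-- height bookkeeping for rules with a list of premisses: a zero-premiss
-- instance may stand at any height bound (its height is 0); otherwise the
-- conclusion has bound one more than the premisses
step : {A : Set} → List A → ℕ → ℕ
step []      n = n
step (_ ∷ _) n = suc n

-- LJ_EV.  Proof n Γ Δ : proofs of Γ ⇒ Δ of height at most n.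
-- Multisets are lists up to permutation: a conclusion "D, Γ" is any list
-- Γ' with Γ' ↭ D ∷ Γ.

data Proof : ℕ → List CD → List CD → Set where
  ax   : ∀ {n Γ Δ Γ' Δ' d d'} c → d ≈u pos c → d' ≈u pos c →
         Γ' ↭ unit d ∷ Γ → Δ' ↭ unit d' ∷ Δ → Proof n Γ' Δ'
  ⊥L   : ∀ {n Γ Δ Γ' d} → d ≈u dbot → Γ' ↭ unit d ∷ Γ → Proof n Γ' Δ
  ⊤R   : ∀ {n Γ Δ Δ' d} → d ≈u dtop → Δ' ↭ unit d ∷ Δ → Proof n Γ Δ'
  ∧L   : ∀ {n Γ Δ Γ' D E} → Proof n (D ∷ E ∷ Γ) Δ →
         Γ' ↭ (D ∧ E) ∷ Γ → Proof (suc n) Γ' Δ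
  ∨L   : ∀ {n Γ Δ Γ' D E} → Proof n (D ∷ Γ) Δ → Proof n (E ∷ Γ) Δ →
         Γ' ↭ (D ∨ E) ∷ Γ → Proof (suc n) Γ' Δ
  →L   : ∀ {n Γ Δ Γ' D E} → Proof n ((D ⟶ E) ∷ Γ) (D ∷ []) → Proof n (E ∷ Γ) Δ →
         Γ' ↭ (D ⟶ E) ∷ Γ → Proof (suc n) Γ' Δ
  ∧R   : ∀ {n Γ Δ Δ' D E} → Proof n Γ (D ∷ Δ) → Proof n Γ (E ∷ Δ) →
         Δ' ↭ (D ∧ E) ∷ Δ → Proof (suc n) Γ Δ'
  ∨R   : ∀ {n Γ Δ Δ' D E} → Proof n Γ (D ∷ E ∷ Δ) →
         Δ' ↭ (D ∨ E) ∷ Δ → Proof (suc n) Γ Δ'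
  →R   : ∀ {n Γ Δ Δ' D E} → Proof n (D ∷ Γ) (E ∷ []) →
         Δ' ↭ (D ⟶ E) ∷ Δ → Proof (suc n) Γ Δ'
  LitL : ∀ {n Γ Γ' Δ d} c → d ≈u neg c → Γ' ↭ unit d ∷ Γ →
         Proof n Γ' (P c ∷ []) → Proof (suc n) Γ' Δ
  LitR : ∀ {n Γ Δ Δ' d} c → d ≈u neg c → Δ' ↭ unit d ∷ Δ →
         Proof n (P c ∷ Γ) [] → Proof (suc n) Γ Δ'
  SepL : ∀ {n Γ Δ Γ' L Z S S₁ S₂} → IsAllZones L Z → TwoDistinct (_∈z S) →
         (∀ z → (z ∈z S) iff (z ∈z S₁ ⊎ z ∈z S₂)) →
         Proof n (unit (ev L Z S₁) ∷ Γ) Δ → Proof n (unit (ev L Z S₂) ∷ Γ) Δ →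
         Γ' ↭ unit (ev L Z S) ∷ Γ → Proof (suc n) Γ' Δ
  SepR : ∀ {n Γ Δ Δ' L Z S S₁ S₂} → IsAllZones L Z → TwoDistinct (_∈z S) →
         (∀ z → (z ∈z S) iff (z ∈z S₁ ⊎ z ∈z S₂)) →
         Proof n Γ (unit (ev L Z S₁) ∷ unit (ev L Z S₂) ∷ Δ) →
         Δ' ↭ unit (ev L Z S) ∷ Δ → Proof (suc n) Γ Δ'
  DecL : ∀ {n Γ Δ Γ' L Z S} z ns os → IsAllZones L Z → S ≐z (z ∷ []) →
         Enum ns (_∈ zin z) → Enum os (_∈ zout z) →
         Proof n (map P ns ++ map N os ++ Γ) Δ →
         Γ' ↭ unit (ev L Z S) ∷ Γ → Proof (suc n) Γ' Δ
  DecR : ∀ {n Γ Δ Δ' L Z S} z ns os → IsAllZones L Z → S ≐z (z ∷ []) →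
         Enum ns (_∈ zin z) → Enum os (_∈ zout z) →
         All (λ c → Proof n Γ (P c ∷ Δ)) ns → All (λ c → Proof n Γ (N c ∷ Δ)) os →
         Δ' ↭ unit (ev L Z S) ∷ Δ → Proof (step (ns ++ os) n) Γ Δ'
  RedL : ∀ {n Γ Δ Γ' L Z} cs ds → RedCond L Z → Enum cs (RedContour L Z) →
         Pointwise (λ c d' → IsDel (eu L Z) c d') cs ds →
         Proof n (map unit ds ++ Γ) Δ →
         Γ' ↭ unit (eu L Z) ∷ Γ → Proof (suc n) Γ' Δ
  RedR : ∀ {n Γ Δ Δ' L Z} cs ds → RedCond L Z → Enum cs (RedContour L Z) →
         Pointwise (λ c d' → IsDel (eu L Z) c d') cs ds →
         All (λ d' → Proof n Γ (unit d' ∷ Δ)) ds →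
         Δ' ↭ unit (eu L Z) ∷ Δ → Proof (step ds n) Γ Δ'
  MSepL : ∀ {n Γ Δ Γ' L Z Z₁ Z₂} → TwoDistinct (Missing L Z) →
          All (ZoneOf L) Z₁ → All (ZoneOf L) Z₂ →
          (∀ z → (z ∈z Z) iff (z ∈z Z₁ × z ∈z Z₂)) →
          Proof n (unit (eu L Z₁) ∷ unit (eu L Z₂) ∷ Γ) Δ →
          Γ' ↭ unit (eu L Z) ∷ Γ → Proof (suc n) Γ' Δ
  MSepR : ∀ {n Γ Δ Δ' L Z Z₁ Z₂} → TwoDistinct (Missing L Z) →
          All (ZoneOf L) Z₁ → All (ZoneOf L) Z₂ →
          (∀ z → (z ∈z Z) iff (z ∈z Z₁ × z ∈z Z₂)) →
          Proof n Γ (unit (eu L Z₁) ∷ Δ) → Proof n Γ (unit (eu L Z₂) ∷ Δ) →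
          Δ' ↭ unit (eu L Z) ∷ Δ → Proof (suc n) Γ Δ'
  ImpDecL : ∀ {n Γ Δ Γ' L Z} z ns os → (∀ w → Missing L Z w iff (w ≈z z)) →
            Enum ns (_∈ zin z) → Enum os (_∈ zout z) →
            All (λ c → Proof n Γ' (P c ∷ [])) ns → All (λ c → Proof n (P c ∷ Γ) Δ) os →
            Γ' ↭ unit (eu L Z) ∷ Γ → Proof (step (ns ++ os) n) Γ' Δ
  ImpDecR : ∀ {n Γ Δ Δ' L Z} z ns os → (∀ w → Missing L Z w iff (w ≈z z)) →
            Enum ns (_∈ zin z) → Enum os (_∈ zout z) →
            Proof n (Γ ++ map P ns) (map P os) →
            Δ' ↭ unit (eu L Z) ∷ Δ → Proof (suc n) Γ Δ'
  -- Euler–Venn diagrams: detachment; Zf represents 𝒵(L) in venn(d)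
  DetL : ∀ {n Γ Δ Γ' L Z S Zf} → IsAllZones L Zf →
         Proof n Γ' (unit (eu L Z) ∷ []) → Proof n (unit (ev L Zf S) ∷ Γ) Δ →
         Γ' ↭ unit (ev L Z S) ∷ Γ → Proof (suc n) Γ' Δ
  DetR : ∀ {n Γ Δ Δ' L Z S Zf} → IsAllZones L Zf →
         Proof n (unit (eu L Z) ∷ Γ) (unit (ev L Zf S) ∷ []) →
         Δ' ↭ unit (ev L Z S) ∷ Δ → Proof (suc n) Γ Δ'

-- Weakening is proved together with exchange: a proof of Γ ⇒ Δ of height n
-- yields one of Γ' ⇒ Δ' of height n whenever Γ' ↭ X ++ Γ and Δ' ↭ Y ++ Δ.  Premisses whose succedent the rule fixes (the left
-- premiss of →L, LitL, ImpDecL and DetL, and the premisses of →R, LitR,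
-- ImpDecR and DetR) receive only the antecedent extension X.
module Submission where

open import Defs
open import Data.Nat using (ℕ)
open import Data.List using (List; []; _∷_; _++_; map)
open import Data.List.Properties using (++-assoc)
open import Data.List.Relation.Unary.All using (All; []; _∷_)
open import Data.List.Relation.Binary.Permutation.Propositional
  using (_↭_; ↭-refl; ↭-trans; ↭-reflexive)
open import Data.List.Relation.Binary.Permutation.Propositional.Properties
  using (++⁺ˡ; ++⁺ʳ; shift; shifts)
open import Data.Product using (_×_; _,_)

↭-focus : ∀ {A : Set} X (a : A) {Γ Γ₀ Γ'} →
          Γ' ↭ X ++ Γ → Γ ↭ a ∷ Γ₀ → Γ' ↭ a ∷ X ++ Γ₀
↭-focus X a {Γ₀ = Γ₀} ext π = ↭-trans ext (↭-trans (++⁺ˡ X π) (shift a X Γ₀))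

↭-extend-prefix : ∀ {A : Set} X (B : List A) {Γ Γ'} →
                  Γ' ↭ X ++ Γ → B ++ Γ' ↭ X ++ B ++ Γ
↭-extend-prefix X B ext = ↭-trans (++⁺ˡ B ext) (shifts B X)

↭-extend-suffix : ∀ {A : Set} X (B : List A) {Γ Γ'} →
                  Γ' ↭ X ++ Γ → Γ' ++ B ↭ X ++ Γ ++ B
↭-extend-suffix X B {Γ} ext = ↭-trans (++⁺ʳ B ext) (↭-reflexive (++-assoc X Γ B))

mutual
  weaken : ∀ {n Γ Δ Γ' Δ'} X Y → Γ' ↭ X ++ Γ → Δ' ↭ Y ++ Δ →
           Proof n Γ Δ → Proof n Γ' Δ'
  weaken X Y g d (ax c e e' π ρ) = ax c e e' (↭-focus X _ g π) (↭-focus Y _ d ρ)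
  weaken X Y g d (⊥L e π) = ⊥L e (↭-focus X _ g π)
  weaken X Y g d (⊤R e ρ) = ⊤R e (↭-focus Y _ d ρ)
  weaken X Y g d (∧L {D = D} {E = E} pr π) =
    ∧L (weaken X Y (shifts (D ∷ E ∷ []) X) d pr) (↭-focus X _ g π)
  weaken X Y g d (∨L {D = D} {E = E} pr pr' π) =
    ∨L (weaken X Y (shifts (D ∷ []) X) d pr) (weaken X Y (shifts (E ∷ []) X) d pr')
       (↭-focus X _ g π)
  weaken X Y g d (→L {D = D} {E = E} pr pr' π) =
    →L (weaken X [] (shifts ((D ⟶ E) ∷ []) X) ↭-refl pr)
       (weaken X Y (shifts (E ∷ []) X) d pr') (↭-focus X _ g π)
  weaken X Y g d (∧R {D = D} {E = E} pr pr' ρ) =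
    ∧R (weaken X Y g (shifts (D ∷ []) Y) pr) (weaken X Y g (shifts (E ∷ []) Y) pr')
       (↭-focus Y _ d ρ)
  weaken X Y g d (∨R {D = D} {E = E} pr ρ) =
    ∨R (weaken X Y g (shifts (D ∷ E ∷ []) Y) pr) (↭-focus Y _ d ρ)
  weaken X Y g d (→R {D = D} pr ρ) =
    →R (weaken X [] (↭-extend-prefix X (D ∷ []) g) ↭-refl pr) (↭-focus Y _ d ρ)
  weaken X Y g d (LitL c e π pr) = LitL c e (↭-focus X _ g π) (weaken X [] g ↭-refl pr)
  weaken X Y g d (LitR c e ρ pr) =
    LitR c e (↭-focus Y _ d ρ) (weaken X [] (↭-extend-prefix X (P c ∷ []) g) ↭-refl pr)
  weaken X Y g d (SepL a b h pr pr' π) =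
    SepL a b h (weaken X Y (shifts (_ ∷ []) X) d pr) (weaken X Y (shifts (_ ∷ []) X) d pr')
         (↭-focus X _ g π)
  weaken X Y g d (SepR a b h pr ρ) =
    SepR a b h (weaken X Y g (shifts (_ ∷ _ ∷ []) Y) pr) (↭-focus Y _ d ρ)
  weaken X Y g d (DecL z ns os a b e f pr π) =
    DecL z ns os a b e f
         (weaken X Y (↭-extend-prefix X (map P ns) (shifts (map N os) X)) d pr)
         (↭-focus X _ g π)
  weaken X Y g d (DecR z ns os a b e f prs prs' ρ) =
    DecR z ns os a b e f (weaken-All X Y (λ _ → g) (λ c → shifts (P c ∷ []) Y) prs)
         (weaken-All X Y (λ _ → g) (λ c → shifts (N c ∷ []) Y) prs')
         (↭-focus Y _ d ρ)
  weaken X Y g d (RedL cs ds a b c pr π) =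
    RedL cs ds a b c (weaken X Y (shifts (map unit ds) X) d pr) (↭-focus X _ g π)
  weaken X Y g d (RedR cs ds a b c prs ρ) =
    RedR cs ds a b c (weaken-All X Y (λ _ → g) (λ d' → shifts (unit d' ∷ []) Y) prs)
         (↭-focus Y _ d ρ)
  weaken X Y g d (MSepL a b c e pr π) =
    MSepL a b c e (weaken X Y (shifts (_ ∷ _ ∷ []) X) d pr) (↭-focus X _ g π)
  weaken X Y g d (MSepR a b c e pr pr' ρ) =
    MSepR a b c e (weaken X Y g (shifts (_ ∷ []) Y) pr) (weaken X Y g (shifts (_ ∷ []) Y) pr')
          (↭-focus Y _ d ρ)
  weaken X Y g d (ImpDecL z ns os a b c prs prs' π) =
    ImpDecL z ns os a b c (weaken-All X [] (λ _ → g) (λ _ → ↭-refl) prs)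
            (weaken-All X Y (λ c → shifts (P c ∷ []) X) (λ _ → d) prs')
            (↭-focus X _ g π)
  weaken X Y g d (ImpDecR z ns os a b c pr ρ) =
    ImpDecR z ns os a b c (weaken X [] (↭-extend-suffix X (map P ns) g) ↭-refl pr)
            (↭-focus Y _ d ρ)
  weaken X Y g d (DetL a pr pr' π) =
    DetL a (weaken X [] g ↭-refl pr) (weaken X Y (shifts (_ ∷ []) X) d pr') (↭-focus X _ g π)
  weaken X Y g d (DetR a pr ρ) =
    DetR a (weaken X [] (↭-extend-prefix X (_ ∷ []) g) ↭-refl pr) (↭-focus Y _ d ρ)

  weaken-All : ∀ {A : Set} {n} {Γ Δ Γ' Δ' : A → List CD} X Y {as} →
               (∀ a → Γ' a ↭ X ++ Γ a) → (∀ a → Δ' a ↭ Y ++ Δ a) →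
               All (λ a → Proof n (Γ a) (Δ a)) as → All (λ a → Proof n (Γ' a) (Δ' a)) as
  weaken-All X Y g d []         = []
  weaken-All X Y g d (pr ∷ prs) = weaken X Y (g _) (d _) pr ∷ weaken-All X Y g d prs

lemma13 : (n : ℕ) (Γ Δ : List CD) (D : CD) →
          All WFD Γ → All WFD Δ → WFD D →
          (Proof n Γ Δ → Proof n (D ∷ Γ) Δ) × (Proof n Γ Δ → Proof n Γ (D ∷ Δ))
lemma13 n Γ Δ D _ _ _ =
  weaken (D ∷ []) [] ↭-refl ↭-refl , weaken [] (D ∷ []) ↭-refl ↭-refl
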